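{- Let $t_1$, $t_2$ and $E$ be terms and $a$ a term variable. If $t_1\equiv t_2$ then $E[a:=t_1]\equiv E[a:=t_2]$.
   Context: Fix pairwise disjoint countably infinite sets of $\lambda$-variables ($x,y,\dots$), stack variables ($\alpha,\beta,\dots$), term variables ($a,b,\dots$), and countable sets of labels $l$ and constructors $C$. Values, terms, stacks, processes: $v,w::=x\mid\lambda x\,t\mid C[v]\mid\{l_i=v_i\}_{i\in I}$; $t,u::=a\mid v\mid t\,u\mid\mu\alpha\,t\mid p\mid v.l\mid\mathrm{case}_v[C_i[x_i]\to t_i]_{i\in I}\mid\delta_{v,w}$; $\pi::=\alpha\mid v.\pi\mid[t]\pi$; $p::=t\ast\pi$; $I$ finite; $\lambda x$, $\mu\alpha$ and the $x_i$ in case branches are binders, term variables are never bound. Substitutions map $\lambda$-variables to values, stack variables to stacks, term variables to terms (capture-avoiding). $\succ$ is the smallest relation on processes with: $t\,u\ast\pi\succ u\ast[t]\pi$; $v\ast[t]\pi\succ t\ast v.\pi$; $\lambda x\,t\ast v.\pi\succ t[x:=v]\ast\pi$; $\mu\alpha\,t\ast\pi\succ t[\alpha:=\pi]\ast\pi$; $p\ast\pi\succ p$; $\{l_i=v_i\}_{i\in I}.l_k\ast\pi\succ v_k\ast\pi$ ($k\in I$); $\mathrm{case}_{C_k[v]}[C_i[x_i]\to t_i]_{i\in I}\ast\pi\succ t_k[x_k:=v]\ast\pi$ ($k\in I$). A process is final if it is $v\ast\alpha$ with $v$ a value and $\alpha$ a stack variable; for a relation $R$, $p\Downarrow_R$ means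 $p\,R^*\,q$ with $q$ final. For $i\in\mathbb N$, inductively: $\rightsquigarrow_i=\succ\cup\{(\delta_{v,w}\ast\pi,v\ast\pi)\mid\exists j<i,\ v\not\equiv_jw\}$; $t\equiv_iu$ iff for all $j\le i$, stacks $\pi$, substitutions $\sigma$: $t\sigma\ast\pi\Downarrow_{\rightsquigarrow_j}\Leftrightarrow u\sigma\ast\pi\Downarrow_{\rightsquigarrow_j}$; $\not\equiv_i$ is its negation. $\equiv=\bigcap_i\equiv_i$. -}

module Defs where

open import Data.Nat using (ℕ; zero; suc; _≤_; _<_; _≡ᵇ_)
open import Data.Nat.Properties using (<-≤-trans)
open import Data.Nat.Induction using (<-wellFounded)
open import Induction.WellFounded using (Acc; acc)
open import Data.Product using (Σ; Σ-syntax; _×_; _,_)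
open import Data.Sum using (_⊎_)
open import Data.List using (List; []; _∷_)
open import Data.Bool using (if_then_else_)
open import Relation.Nullary using (¬_)
open import Relation.Binary.PropositionalEquality using (_≡_; _≢_)
open import Relation.Binary.Construct.Closure.ReflexiveTransitive using (Star)
open import Function using (id)

-- Syntax.  λ-variables and stack variables are de Bruijn indices (they
-- are the bound sorts); term variables are names a : ℕ (never bound).
-- Labels and constructors are natural numbers.
--   lam t          : λx t        (binds λ-index 0 in t)
--   mu t           : μα t        (binds stack-index 0 in t)
--   case v bs      : case_v [C_i[x_i] → t_i]  with bs = list of (C_i , t_i),
--                    each t_i binding λ-index 0 (the x_i)
--   rec fs         : {l_i = v_i}   with fs = list of (l_i , v_i)

mutual
  data Val : Set where
    var : ℕ → Val
    lam : Term → Val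
    con : ℕ → Val → Val
    rec : List (ℕ × Val) → Val

  data Term : Set where
    tvar  : ℕ → Term
    val   : Val → Term
    app   : Term → Term → Term
    mu    : Term → Term
    proc  : Proc → Term
    proj  : Val → ℕ → Term
    case  : Val → List (ℕ × Term) → Term
    delta : Val → Val → Term

  data Stack : Set where
    svar  : ℕ → Stack
    push  : Val → Stack → Stack
    frame : Term → Stack → Stack

  data Proc : Set where
    _∗_ : Term → Stack → Proc

infix 4 _∗_

ext : (ℕ → ℕ) → ℕ → ℕ
ext ρ zero    = zero
ext ρ (suc n) = suc (ρ n)

mutual
  renV : (ℕ → ℕ) → (ℕ → ℕ) → Val → Val
  renV ρ τ (var x)   = var (ρ x)
  renV ρ τ (lam t)   = lam (renT (ext ρ) τ t)
  renV ρ τ (con c v) = con c (renV ρ τ v)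
  renV ρ τ (rec fs)  = rec (renFs ρ τ fs)

  renFs : (ℕ → ℕ) → (ℕ → ℕ) → List (ℕ × Val) → List (ℕ × Val)
  renFs ρ τ []             = []
  renFs ρ τ ((l , v) ∷ fs) = (l , renV ρ τ v) ∷ renFs ρ τ fs

  renT : (ℕ → ℕ) → (ℕ → ℕ) → Term → Term
  renT ρ τ (tvar a)    = tvar a
  renT ρ τ (val v)     = val (renV ρ τ v)
  renT ρ τ (app t u)   = app (renT ρ τ t) (renT ρ τ u)
  renT ρ τ (mu t)      = mu (renT ρ (ext τ) t)
  renT ρ τ (proc p)    = proc (renP ρ τ p)
  renT ρ τ (proj v l)  = proj (renV ρ τ v) l
  renT ρ τ (case v bs) = case (renV ρ τ v) (renBs ρ τ bs)
  renT ρ τ (delta v w) = delta (renV ρ τ v) (renV ρ τ w)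

  renBs : (ℕ → ℕ) → (ℕ → ℕ) → List (ℕ × Term) → List (ℕ × Term)
  renBs ρ τ []             = []
  renBs ρ τ ((c , t) ∷ bs) = (c , renT (ext ρ) τ t) ∷ renBs ρ τ bs

  renS : (ℕ → ℕ) → (ℕ → ℕ) → Stack → Stack
  renS ρ τ (svar α)    = svar (τ α)
  renS ρ τ (push v π)  = push (renV ρ τ v) (renS ρ τ π)
  renS ρ τ (frame t π) = frame (renT ρ τ t) (renS ρ τ π)

  renP : (ℕ → ℕ) → (ℕ → ℕ) → Proc → Proc
  renP ρ τ (t ∗ π) = renT ρ τ t ∗ renS ρ τ π

record Subst : Set where
  constructor ⟨_,_,_⟩
  field
    sv : ℕ → Val
    ss : ℕ → Stack
    st : ℕ → Term
open Subst public

liftλ : Subst → Subst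
liftλ σ = ⟨ f , (λ n → renS suc id (ss σ n)) , (λ n → renT suc id (st σ n)) ⟩
  where
  f : ℕ → Val
  f zero    = var zero
  f (suc n) = renV suc id (sv σ n)

liftμ : Subst → Subst
liftμ σ = ⟨ (λ n → renV id suc (sv σ n)) , g , (λ n → renT id suc (st σ n)) ⟩
  where
  g : ℕ → Stack
  g zero    = svar zero
  g (suc n) = renS id suc (ss σ n)

mutual
  subV : Val → Subst → Val
  subV (var x)   σ = sv σ x
  subV (lam t)   σ = lam (subT t (liftλ σ))
  subV (con c v) σ = con c (subV v σ)
  subV (rec fs)  σ = rec (subFs fs σ)

  subFs : List (ℕ × Val) → Subst → List (ℕ × Val)
  subFs []             σ = []
  subFs ((l , v) ∷ fs) σ = (l , subV v σ) ∷ subFs fs σ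

  subT : Term → Subst → Term
  subT (tvar a)    σ = st σ a
  subT (val v)     σ = val (subV v σ)
  subT (app t u)   σ = app (subT t σ) (subT u σ)
  subT (mu t)      σ = mu (subT t (liftμ σ))
  subT (proc p)    σ = proc (subP p σ)
  subT (proj v l)  σ = proj (subV v σ) l
  subT (case v bs) σ = case (subV v σ) (subBs bs σ)
  subT (delta v w) σ = delta (subV v σ) (subV w σ)

  subBs : List (ℕ × Term) → Subst → List (ℕ × Term)
  subBs []             σ = []
  subBs ((c , t) ∷ bs) σ = (c , subT t (liftλ σ)) ∷ subBs bs σ

  subS : Stack → Subst → Stack
  subS (svar α)    σ = ss σ α
  subS (push v π)  σ = push (subV v σ) (subS π σ)
  subS (frame t π) σ = frame (subT t σ) (subS π σ)

  subP : Proc → Subst → Proc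
  subP (t ∗ π) σ = subT t σ ∗ subS π σ

_[x≔_] : Term → Val → Term
t [x≔ v ] = subT t ⟨ f , svar , tvar ⟩
  where
  f : ℕ → Val
  f zero    = v
  f (suc n) = var n

_[α≔_] : Term → Stack → Term
t [α≔ π ] = subT t ⟨ var , g , tvar ⟩
  where
  g : ℕ → Stack
  g zero    = π
  g (suc n) = svar n

_[_≔_] : Term → ℕ → Term → Term
E [ a ≔ t ] = subT E ⟨ var , svar , (λ b → if a ≡ᵇ b then t else tvar b) ⟩

data Lookup {A : Set} (k : ℕ) : List (ℕ × A) → A → Set where
  here  : ∀ {y xs} → Lookup k ((k , y) ∷ xs) y
  there : ∀ {k' y' y xs} → k ≢ k' → Lookup k xs y → Lookup k ((k' , y') ∷ xs) y

data _≻_ : Proc → Proc → Set where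
  ≻-app   : ∀ {t u π} → (app t u ∗ π) ≻ (u ∗ frame t π)
  ≻-frame : ∀ {v t π} → (val v ∗ frame t π) ≻ (t ∗ push v π)
  ≻-lam   : ∀ {t v π} → (val (lam t) ∗ push v π) ≻ (t [x≔ v ] ∗ π)
  ≻-mu    : ∀ {t π} → (mu t ∗ π) ≻ (t [α≔ π ] ∗ π)
  ≻-proc  : ∀ {p π} → (proc p ∗ π) ≻ p
  ≻-proj  : ∀ {fs l v π} → Lookup l fs v → (proj (rec fs) l ∗ π) ≻ (val v ∗ π)
  ≻-case  : ∀ {c v bs t π} → Lookup c bs t →
            (case (con c v) bs ∗ π) ≻ (t [x≔ v ] ∗ π)

data Final : Proc → Set where
  final : ∀ {v α} → Final (val v ∗ svar α)

Halts : (Proc → Proc → Set) → Proc → Set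
Halts R p = Σ[ q ∈ Proc ] (Star R p q × Final q)

StepWith : (i : ℕ) → (∀ k → k < i → Term → Term → Set) → Proc → Proc → Set
StepWith i E p q =
  (p ≻ q) ⊎
  (Σ[ v ∈ Val ] Σ[ w ∈ Val ] Σ[ π ∈ Stack ]
     (p ≡ (delta v w ∗ π)) × (q ≡ (val v ∗ π)) ×
     (Σ[ k ∈ ℕ ] Σ[ k<i ∈ k < i ] ¬ E k k<i (val v) (val w)))

EquivAcc : (i : ℕ) → Acc _<_ i → Term → Term → Set
EquivAcc i (acc rs) t u =
  ∀ j (j≤i : j ≤ i) (π : Stack) (σ : Subst) →
    let R = StepWith j (λ k k<j → EquivAcc k (rs (<-≤-trans k<j j≤i))) in
    (Halts R (subT t σ ∗ π) → Halts R (subT u σ ∗ π)) ×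
    (Halts R (subT u σ ∗ π) → Halts R (subT t σ ∗ π))

_≡[_]_ : Term → ℕ → Term → Set
t ≡[ i ] u = EquivAcc i (<-wellFounded i) t u

⇝ : ℕ → Proc → Proc → Set
⇝ i = StepWith i (λ k _ → λ t u → t ≡[ k ] u)

_≈_ : Term → Term → Set
t ≈ u = ∀ i → t ≡[ i ] u

-- Let ~ be the compatible closure (on values, terms, stacks, processes and
-- substitutions) of the pairs tθ ~ t'θ' with t ≈ t' and θ ~ θ' pointwise.  It is
-- closed under renaming, substitution and symmetry, and relates E[a:=t₁] to
-- E[a:=t₂].  By well-founded induction on i, related terms are ≡_i: a halting
-- ⇝_j-reduction of tσ ∗ π is replayed step by step on the related side.  Each ≻-step
-- preserves ~ because ~ is closed under substitution; a δ_{v,w}-step is matched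
-- because related values are ≡_k for k < j by induction; and at an instance tθ ~ t'θ'
-- one first replays the reduction on tθ' and then uses t ≈ t'.

module Submission where

open import Defs
open import Data.Nat using (ℕ; zero; suc; _<_; _≡ᵇ_)
open import Data.Nat.Properties using (<-≤-trans)
open import Data.Nat.Induction using (<-wellFounded)
open import Data.Bool using (true; false; if_then_else_)
open import Data.Product using (Σ-syntax; _×_; _,_; proj₁; proj₂; swap)
open import Data.Sum using (inj₁; inj₂)
open import Data.List using (List; []; _∷_)
open import Function using (_∘_; id)
open import Induction.WellFounded using (Acc; acc)
open import Relation.Binary.PropositionalEquality
  using (_≡_; refl; sym; trans; cong; cong₂; subst₂; _≗_)
open import Relation.Binary.Construct.Closure.ReflexiveTransitive
  using (Star; ε; _◅_)
import Relation.Binary.Construct.Closure.ReflexiveTransitive as Star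

private variable
  ρ ρ₁ ρ₂ ρ₁' ρ₂' τ τ₁ τ₂ τ₁' τ₂' : ℕ → ℕ
  σ σ' θ θ' : Subst
  v v' w w' : Val
  t t' u u' : Term
  fs fs' : List (ℕ × Val)
  bs bs' : List (ℕ × Term)
  π π' : Stack
  p p' : Proc

ext-comm : ρ₂ ∘ ρ₁ ≗ ρ₂' ∘ ρ₁' → ext ρ₂ ∘ ext ρ₁ ≗ ext ρ₂' ∘ ext ρ₁'
ext-comm h zero    = refl
ext-comm h (suc n) = cong suc (h n)

mutual
  renV-comm : ρ₂ ∘ ρ₁ ≗ ρ₂' ∘ ρ₁' → τ₂ ∘ τ₁ ≗ τ₂' ∘ τ₁' →
              ∀ v → renV ρ₂ τ₂ (renV ρ₁ τ₁ v) ≡ renV ρ₂' τ₂' (renV ρ₁' τ₁' v)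
  renV-comm hρ hτ (var x)   = cong var (hρ x)
  renV-comm hρ hτ (lam t)   = cong lam (renT-comm (ext-comm hρ) hτ t)
  renV-comm hρ hτ (con c v) = cong (con c) (renV-comm hρ hτ v)
  renV-comm hρ hτ (rec fs)  = cong rec (renFs-comm hρ hτ fs)

  renFs-comm : ρ₂ ∘ ρ₁ ≗ ρ₂' ∘ ρ₁' → τ₂ ∘ τ₁ ≗ τ₂' ∘ τ₁' →
               ∀ fs → renFs ρ₂ τ₂ (renFs ρ₁ τ₁ fs) ≡ renFs ρ₂' τ₂' (renFs ρ₁' τ₁' fs)
  renFs-comm hρ hτ []             = refl
  renFs-comm hρ hτ ((l , v) ∷ fs) = cong₂ (λ v fs → (l , v) ∷ fs) (renV-comm hρ hτ v) (renFs-comm hρ hτ fs)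

  renT-comm : ρ₂ ∘ ρ₁ ≗ ρ₂' ∘ ρ₁' → τ₂ ∘ τ₁ ≗ τ₂' ∘ τ₁' →
              ∀ t → renT ρ₂ τ₂ (renT ρ₁ τ₁ t) ≡ renT ρ₂' τ₂' (renT ρ₁' τ₁' t)
  renT-comm hρ hτ (tvar a)    = refl
  renT-comm hρ hτ (val v)     = cong val (renV-comm hρ hτ v)
  renT-comm hρ hτ (app t u)   = cong₂ app (renT-comm hρ hτ t) (renT-comm hρ hτ u)
  renT-comm hρ hτ (mu t)      = cong mu (renT-comm hρ (ext-comm hτ) t)
  renT-comm hρ hτ (proc p)    = cong proc (renP-comm hρ hτ p)
  renT-comm hρ hτ (proj v l)  = cong (λ v → proj v l) (renV-comm hρ hτ v)
  renT-comm hρ hτ (case v bs) = cong₂ case (renV-comm hρ hτ v) (renBs-comm hρ hτ bs)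
  renT-comm hρ hτ (delta v w) = cong₂ delta (renV-comm hρ hτ v) (renV-comm hρ hτ w)

  renBs-comm : ρ₂ ∘ ρ₁ ≗ ρ₂' ∘ ρ₁' → τ₂ ∘ τ₁ ≗ τ₂' ∘ τ₁' →
               ∀ bs → renBs ρ₂ τ₂ (renBs ρ₁ τ₁ bs) ≡ renBs ρ₂' τ₂' (renBs ρ₁' τ₁' bs)
  renBs-comm hρ hτ []             = refl
  renBs-comm hρ hτ ((c , t) ∷ bs) = cong₂ (λ t bs → (c , t) ∷ bs) (renT-comm (ext-comm hρ) hτ t) (renBs-comm hρ hτ bs)

  renS-comm : ρ₂ ∘ ρ₁ ≗ ρ₂' ∘ ρ₁' → τ₂ ∘ τ₁ ≗ τ₂' ∘ τ₁' →
              ∀ π → renS ρ₂ τ₂ (renS ρ₁ τ₁ π) ≡ renS ρ₂' τ₂' (renS ρ₁' τ₁' π)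
  renS-comm hρ hτ (svar α)    = cong svar (hτ α)
  renS-comm hρ hτ (push v π)  = cong₂ push (renV-comm hρ hτ v) (renS-comm hρ hτ π)
  renS-comm hρ hτ (frame t π) = cong₂ frame (renT-comm hρ hτ t) (renS-comm hρ hτ π)

  renP-comm : ρ₂ ∘ ρ₁ ≗ ρ₂' ∘ ρ₁' → τ₂ ∘ τ₁ ≗ τ₂' ∘ τ₁' →
              ∀ p → renP ρ₂ τ₂ (renP ρ₁ τ₁ p) ≡ renP ρ₂' τ₂' (renP ρ₁' τ₁' p)
  renP-comm hρ hτ (t ∗ π) = cong₂ _∗_ (renT-comm hρ hτ t) (renS-comm hρ hτ π)

infix 4 _≗ˢ_
infixl 5 _⨾_

record _≗ˢ_ (σ σ' : Subst) : Set where
  constructor pointwise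
  field
    sv-≗ : sv σ ≗ sv σ'
    ss-≗ : ss σ ≗ ss σ'
    st-≗ : st σ ≗ st σ'
open _≗ˢ_

≗ˢ-refl : σ ≗ˢ σ
≗ˢ-refl = pointwise (λ _ → refl) (λ _ → refl) (λ _ → refl)

idˢ : Subst
idˢ = ⟨ var , svar , tvar ⟩

renameSubst : (ℕ → ℕ) → (ℕ → ℕ) → Subst → Subst
renameSubst ρ τ σ = ⟨ renV ρ τ ∘ sv σ , renS ρ τ ∘ ss σ , renT ρ τ ∘ st σ ⟩

reindexSubst : (ℕ → ℕ) → (ℕ → ℕ) → Subst → Subst
reindexSubst ρ τ σ = ⟨ sv σ ∘ ρ , ss σ ∘ τ , st σ ⟩

_⨾_ : Subst → Subst → Subst
θ ⨾ σ = ⟨ (λ n → subV (sv θ n) σ) , (λ n → subS (ss θ n) σ) , (λ n → subT (st θ n) σ) ⟩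

reindex-liftλ : reindexSubst ρ τ σ ≗ˢ σ' → reindexSubst (ext ρ) τ (liftλ σ) ≗ˢ liftλ σ'
reindex-liftλ h = pointwise (λ { zero → refl ; (suc n) → cong (renV suc id) (sv-≗ h n) })
                            (cong (renS suc id) ∘ ss-≗ h) (cong (renT suc id) ∘ st-≗ h)

reindex-liftμ : reindexSubst ρ τ σ ≗ˢ σ' → reindexSubst ρ (ext τ) (liftμ σ) ≗ˢ liftμ σ'
reindex-liftμ h = pointwise (cong (renV id suc) ∘ sv-≗ h)
                            (λ { zero → refl ; (suc n) → cong (renS id suc) (ss-≗ h n) })
                            (cong (renT id suc) ∘ st-≗ h)

mutual
  subV-renV : reindexSubst ρ τ σ ≗ˢ σ' → ∀ v → subV (renV ρ τ v) σ ≡ subV v σ'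
  subV-renV h (var x)   = sv-≗ h x
  subV-renV h (lam t)   = cong lam (subT-renT (reindex-liftλ h) t)
  subV-renV h (con c v) = cong (con c) (subV-renV h v)
  subV-renV h (rec fs)  = cong rec (subFs-renFs h fs)

  subFs-renFs : reindexSubst ρ τ σ ≗ˢ σ' → ∀ fs → subFs (renFs ρ τ fs) σ ≡ subFs fs σ'
  subFs-renFs h []             = refl
  subFs-renFs h ((l , v) ∷ fs) = cong₂ (λ v fs → (l , v) ∷ fs) (subV-renV h v) (subFs-renFs h fs)

  subT-renT : reindexSubst ρ τ σ ≗ˢ σ' → ∀ t → subT (renT ρ τ t) σ ≡ subT t σ'
  subT-renT h (tvar a)    = st-≗ h a
  subT-renT h (val v)     = cong val (subV-renV h v)
  subT-renT h (app t u)   = cong₂ app (subT-renT h t) (subT-renT h u)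
  subT-renT h (mu t)      = cong mu (subT-renT (reindex-liftμ h) t)
  subT-renT h (proc p)    = cong proc (subP-renP h p)
  subT-renT h (proj v l)  = cong (λ v → proj v l) (subV-renV h v)
  subT-renT h (case v bs) = cong₂ case (subV-renV h v) (subBs-renBs h bs)
  subT-renT h (delta v w) = cong₂ delta (subV-renV h v) (subV-renV h w)

  subBs-renBs : reindexSubst ρ τ σ ≗ˢ σ' → ∀ bs → subBs (renBs ρ τ bs) σ ≡ subBs bs σ'
  subBs-renBs h []             = refl
  subBs-renBs h ((c , t) ∷ bs) = cong₂ (λ t bs → (c , t) ∷ bs) (subT-renT (reindex-liftλ h) t) (subBs-renBs h bs)

  subS-renS : reindexSubst ρ τ σ ≗ˢ σ' → ∀ π → subS (renS ρ τ π) σ ≡ subS π σ'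
  subS-renS h (svar α)    = ss-≗ h α
  subS-renS h (push v π)  = cong₂ push (subV-renV h v) (subS-renS h π)
  subS-renS h (frame t π) = cong₂ frame (subT-renT h t) (subS-renS h π)

  subP-renP : reindexSubst ρ τ σ ≗ˢ σ' → ∀ p → subP (renP ρ τ p) σ ≡ subP p σ'
  subP-renP h (t ∗ π) = cong₂ _∗_ (subT-renT h t) (subS-renS h π)

rename-liftλ : renameSubst ρ τ σ ≗ˢ σ' → renameSubst (ext ρ) τ (liftλ σ) ≗ˢ liftλ σ'
rename-liftλ {σ = σ} h = pointwise
  (λ { zero → refl ; (suc n) → trans (renV-comm (λ _ → refl) (λ _ → refl) (sv σ n)) (cong (renV suc id) (sv-≗ h n)) })
  (λ n → trans (renS-comm (λ _ → refl) (λ _ → refl) (ss σ n)) (cong (renS suc id) (ss-≗ h n)))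
  (λ n → trans (renT-comm (λ _ → refl) (λ _ → refl) (st σ n)) (cong (renT suc id) (st-≗ h n)))

rename-liftμ : renameSubst ρ τ σ ≗ˢ σ' → renameSubst ρ (ext τ) (liftμ σ) ≗ˢ liftμ σ'
rename-liftμ {σ = σ} h = pointwise
  (λ n → trans (renV-comm (λ _ → refl) (λ _ → refl) (sv σ n)) (cong (renV id suc) (sv-≗ h n)))
  (λ { zero → refl ; (suc n) → trans (renS-comm (λ _ → refl) (λ _ → refl) (ss σ n)) (cong (renS id suc) (ss-≗ h n)) })
  (λ n → trans (renT-comm (λ _ → refl) (λ _ → refl) (st σ n)) (cong (renT id suc) (st-≗ h n)))

mutual
  renV-subV : renameSubst ρ τ σ ≗ˢ σ' → ∀ v → renV ρ τ (subV v σ) ≡ subV v σ'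
  renV-subV h (var x)   = sv-≗ h x
  renV-subV h (lam t)   = cong lam (renT-subT (rename-liftλ h) t)
  renV-subV h (con c v) = cong (con c) (renV-subV h v)
  renV-subV h (rec fs)  = cong rec (renFs-subFs h fs)

  renFs-subFs : renameSubst ρ τ σ ≗ˢ σ' → ∀ fs → renFs ρ τ (subFs fs σ) ≡ subFs fs σ'
  renFs-subFs h []             = refl
  renFs-subFs h ((l , v) ∷ fs) = cong₂ (λ v fs → (l , v) ∷ fs) (renV-subV h v) (renFs-subFs h fs)

  renT-subT : renameSubst ρ τ σ ≗ˢ σ' → ∀ t → renT ρ τ (subT t σ) ≡ subT t σ'
  renT-subT h (tvar a)    = st-≗ h a
  renT-subT h (val v)     = cong val (renV-subV h v)
  renT-subT h (app t u)   = cong₂ app (renT-subT h t) (renT-subT h u)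
  renT-subT h (mu t)      = cong mu (renT-subT (rename-liftμ h) t)
  renT-subT h (proc p)    = cong proc (renP-subP h p)
  renT-subT h (proj v l)  = cong (λ v → proj v l) (renV-subV h v)
  renT-subT h (case v bs) = cong₂ case (renV-subV h v) (renBs-subBs h bs)
  renT-subT h (delta v w) = cong₂ delta (renV-subV h v) (renV-subV h w)

  renBs-subBs : renameSubst ρ τ σ ≗ˢ σ' → ∀ bs → renBs ρ τ (subBs bs σ) ≡ subBs bs σ'
  renBs-subBs h []             = refl
  renBs-subBs h ((c , t) ∷ bs) = cong₂ (λ t bs → (c , t) ∷ bs) (renT-subT (rename-liftλ h) t) (renBs-subBs h bs)

  renS-subS : renameSubst ρ τ σ ≗ˢ σ' → ∀ π → renS ρ τ (subS π σ) ≡ subS π σ'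
  renS-subS h (svar α)    = ss-≗ h α
  renS-subS h (push v π)  = cong₂ push (renV-subV h v) (renS-subS h π)
  renS-subS h (frame t π) = cong₂ frame (renT-subT h t) (renS-subS h π)

  renP-subP : renameSubst ρ τ σ ≗ˢ σ' → ∀ p → renP ρ τ (subP p σ) ≡ subP p σ'
  renP-subP h (t ∗ π) = cong₂ _∗_ (renT-subT h t) (renS-subS h π)

⨾-liftλ : θ ⨾ σ ≗ˢ σ' → liftλ θ ⨾ liftλ σ ≗ˢ liftλ σ'
⨾-liftλ {θ} h = pointwise
  (λ { zero → refl ; (suc n) → trans (subV-renV ≗ˢ-refl (sv θ n)) (trans (sym (renV-subV ≗ˢ-refl (sv θ n))) (cong (renV suc id) (sv-≗ h n))) })
  (λ n → trans (subS-renS ≗ˢ-refl (ss θ n)) (trans (sym (renS-subS ≗ˢ-refl (ss θ n))) (cong (renS suc id) (ss-≗ h n))))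
  (λ n → trans (subT-renT ≗ˢ-refl (st θ n)) (trans (sym (renT-subT ≗ˢ-refl (st θ n))) (cong (renT suc id) (st-≗ h n))))

⨾-liftμ : θ ⨾ σ ≗ˢ σ' → liftμ θ ⨾ liftμ σ ≗ˢ liftμ σ'
⨾-liftμ {θ} h = pointwise
  (λ n → trans (subV-renV ≗ˢ-refl (sv θ n)) (trans (sym (renV-subV ≗ˢ-refl (sv θ n))) (cong (renV id suc) (sv-≗ h n))))
  (λ { zero → refl ; (suc n) → trans (subS-renS ≗ˢ-refl (ss θ n)) (trans (sym (renS-subS ≗ˢ-refl (ss θ n))) (cong (renS id suc) (ss-≗ h n))) })
  (λ n → trans (subT-renT ≗ˢ-refl (st θ n)) (trans (sym (renT-subT ≗ˢ-refl (st θ n))) (cong (renT id suc) (st-≗ h n))))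

mutual
  subV-subV : θ ⨾ σ ≗ˢ σ' → ∀ v → subV (subV v θ) σ ≡ subV v σ'
  subV-subV h (var x)   = sv-≗ h x
  subV-subV h (lam t)   = cong lam (subT-subT (⨾-liftλ h) t)
  subV-subV h (con c v) = cong (con c) (subV-subV h v)
  subV-subV h (rec fs)  = cong rec (subFs-subFs h fs)

  subFs-subFs : θ ⨾ σ ≗ˢ σ' → ∀ fs → subFs (subFs fs θ) σ ≡ subFs fs σ'
  subFs-subFs h []             = refl
  subFs-subFs h ((l , v) ∷ fs) = cong₂ (λ v fs → (l , v) ∷ fs) (subV-subV h v) (subFs-subFs h fs)

  subT-subT : θ ⨾ σ ≗ˢ σ' → ∀ t → subT (subT t θ) σ ≡ subT t σ'
  subT-subT h (tvar a)    = st-≗ h a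
  subT-subT h (val v)     = cong val (subV-subV h v)
  subT-subT h (app t u)   = cong₂ app (subT-subT h t) (subT-subT h u)
  subT-subT h (mu t)      = cong mu (subT-subT (⨾-liftμ h) t)
  subT-subT h (proc p)    = cong proc (subP-subP h p)
  subT-subT h (proj v l)  = cong (λ v → proj v l) (subV-subV h v)
  subT-subT h (case v bs) = cong₂ case (subV-subV h v) (subBs-subBs h bs)
  subT-subT h (delta v w) = cong₂ delta (subV-subV h v) (subV-subV h w)

  subBs-subBs : θ ⨾ σ ≗ˢ σ' → ∀ bs → subBs (subBs bs θ) σ ≡ subBs bs σ'
  subBs-subBs h []             = refl
  subBs-subBs h ((c , t) ∷ bs) = cong₂ (λ t bs → (c , t) ∷ bs) (subT-subT (⨾-liftλ h) t) (subBs-subBs h bs)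

  subS-subS : θ ⨾ σ ≗ˢ σ' → ∀ π → subS (subS π θ) σ ≡ subS π σ'
  subS-subS h (svar α)    = ss-≗ h α
  subS-subS h (push v π)  = cong₂ push (subV-subV h v) (subS-subS h π)
  subS-subS h (frame t π) = cong₂ frame (subT-subT h t) (subS-subS h π)

  subP-subP : θ ⨾ σ ≗ˢ σ' → ∀ p → subP (subP p θ) σ ≡ subP p σ'
  subP-subP h (t ∗ π) = cong₂ _∗_ (subT-subT h t) (subS-subS h π)

idˢ-liftλ : σ ≗ˢ idˢ → liftλ σ ≗ˢ idˢ
idˢ-liftλ h = pointwise (λ { zero → refl ; (suc n) → cong (renV suc id) (sv-≗ h n) })
                        (cong (renS suc id) ∘ ss-≗ h) (cong (renT suc id) ∘ st-≗ h)

idˢ-liftμ : σ ≗ˢ idˢ → liftμ σ ≗ˢ idˢ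
idˢ-liftμ h = pointwise (cong (renV id suc) ∘ sv-≗ h)
                        (λ { zero → refl ; (suc n) → cong (renS id suc) (ss-≗ h n) })
                        (cong (renT id suc) ∘ st-≗ h)

mutual
  subV-id : σ ≗ˢ idˢ → ∀ v → subV v σ ≡ v
  subV-id h (var x)   = sv-≗ h x
  subV-id h (lam t)   = cong lam (subT-id (idˢ-liftλ h) t)
  subV-id h (con c v) = cong (con c) (subV-id h v)
  subV-id h (rec fs)  = cong rec (subFs-id h fs)

  subFs-id : σ ≗ˢ idˢ → ∀ fs → subFs fs σ ≡ fs
  subFs-id h []             = refl
  subFs-id h ((l , v) ∷ fs) = cong₂ (λ v fs → (l , v) ∷ fs) (subV-id h v) (subFs-id h fs)

  subT-id : σ ≗ˢ idˢ → ∀ t → subT t σ ≡ t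
  subT-id h (tvar a)    = st-≗ h a
  subT-id h (val v)     = cong val (subV-id h v)
  subT-id h (app t u)   = cong₂ app (subT-id h t) (subT-id h u)
  subT-id h (mu t)      = cong mu (subT-id (idˢ-liftμ h) t)
  subT-id h (proc p)    = cong proc (subP-id h p)
  subT-id h (proj v l)  = cong (λ v → proj v l) (subV-id h v)
  subT-id h (case v bs) = cong₂ case (subV-id h v) (subBs-id h bs)
  subT-id h (delta v w) = cong₂ delta (subV-id h v) (subV-id h w)

  subBs-id : σ ≗ˢ idˢ → ∀ bs → subBs bs σ ≡ bs
  subBs-id h []             = refl
  subBs-id h ((c , t) ∷ bs) = cong₂ (λ t bs → (c , t) ∷ bs) (subT-id (idˢ-liftλ h) t) (subBs-id h bs)

  subS-id : σ ≗ˢ idˢ → ∀ π → subS π σ ≡ π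
  subS-id h (svar α)    = ss-≗ h α
  subS-id h (push v π)  = cong₂ push (subV-id h v) (subS-id h π)
  subS-id h (frame t π) = cong₂ frame (subT-id h t) (subS-id h π)

  subP-id : σ ≗ˢ idˢ → ∀ p → subP p σ ≡ p
  subP-id h (t ∗ π) = cong₂ _∗_ (subT-id h t) (subS-id h π)

Halts-map : ∀ {R R' : Proc → Proc → Set} → (∀ {p q} → R p q → R' p q) → ∀ {p} → Halts R p → Halts R' p
Halts-map f (q , s , fin) = q , Star.map f s , fin

infixr 5 _◅ₕ_

_◅ₕ_ : ∀ {R : Proc → Proc → Set} {p p'} → R p p' → Halts R p' → Halts R p
r ◅ₕ (q , s , fin) = q , r ◅ s , fin

StepWith-antimono : ∀ {i} {E E' : ∀ k → k < i → Term → Term → Set} →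
                    (∀ k k<i t u → E' k k<i t u → E k k<i t u) →
                    ∀ {p q} → StepWith i E p q → StepWith i E' p q
StepWith-antimono h (inj₁ r) = inj₁ r
StepWith-antimono h (inj₂ (v , w , π , p≡ , q≡ , k , k<i , v≢w)) =
  inj₂ (v , w , π , p≡ , q≡ , k , k<i , v≢w ∘ h k k<i (val v) (val w))

EquivAcc-sym : ∀ {i} (a : Acc _<_ i) {t u} → EquivAcc i a t u → EquivAcc i a u t
EquivAcc-sym (acc rs) h j j≤i π σ = swap (h j j≤i π σ)

EquivAcc-trans : ∀ {i} (a : Acc _<_ i) {t u w} → EquivAcc i a t u → EquivAcc i a u w → EquivAcc i a t w
EquivAcc-trans (acc rs) h h' j j≤i π σ =
  proj₁ (h' j j≤i π σ) ∘ proj₁ (h j j≤i π σ) , proj₂ (h j j≤i π σ) ∘ proj₂ (h' j j≤i π σ)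

EquivAcc-irrelevant : ∀ {i} (a b : Acc _<_ i) {t u} → EquivAcc i a t u → EquivAcc i b t u
EquivAcc-irrelevant (acc rs) (acc rs') h j j≤i π σ =
  Halts-map to ∘ proj₁ (h j j≤i π σ) ∘ Halts-map from , Halts-map to ∘ proj₂ (h j j≤i π σ) ∘ Halts-map from
  where
  E E' : ∀ k → k < j → Term → Term → Set
  E  k k<j = EquivAcc k (rs  (<-≤-trans k<j j≤i))
  E' k k<j = EquivAcc k (rs' (<-≤-trans k<j j≤i))
  to : ∀ {p q} → StepWith j E p q → StepWith j E' p q
  to = StepWith-antimono (λ k k<j t u → EquivAcc-irrelevant (rs' (<-≤-trans k<j j≤i)) (rs (<-≤-trans k<j j≤i)) {t} {u})
  from : ∀ {p q} → StepWith j E' p q → StepWith j E p q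
  from = StepWith-antimono (λ k k<j t u → EquivAcc-irrelevant (rs (<-≤-trans k<j j≤i)) (rs' (<-≤-trans k<j j≤i)) {t} {u})

≈-sym : ∀ {t u} → t ≈ u → u ≈ t
≈-sym {t} {u} g i = EquivAcc-sym (<-wellFounded i) {t} {u} (g i)

infix 4 _~V_ _~F_ _~H_ _~T_ _~B_ _~S_ _~P_ _~σ_

-- The compatible closure of the ≈-instances.  _~H_ is its layer in which both sides
-- share their outermost term former; splitting it off lets the simulation below
-- unfold an ≈-instance while recursing structurally on the reduction sequence.
mutual
  data _~V_ : Val → Val → Set where
    var : ∀ x → var x ~V var x
    lam : t ~T t' → lam t ~V lam t'
    con : ∀ c → v ~V v' → con c v ~V con c v'
    rec : fs ~F fs' → rec fs ~V rec fs'

  data _~F_ : List (ℕ × Val) → List (ℕ × Val) → Set where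
    []  : [] ~F []
    _∷_ : ∀ {l} → v ~V v' → fs ~F fs' → (l , v) ∷ fs ~F (l , v') ∷ fs'

  data _~H_ : Term → Term → Set where
    tvar  : ∀ a → tvar a ~H tvar a
    val   : v ~V v' → val v ~H val v'
    app   : t ~T t' → u ~T u' → app t u ~H app t' u'
    mu    : t ~T t' → mu t ~H mu t'
    proc  : p ~P p' → proc p ~H proc p'
    proj  : v ~V v' → ∀ l → proj v l ~H proj v' l
    case  : v ~V v' → bs ~B bs' → case v bs ~H case v' bs'
    delta : v ~V v' → w ~V w' → delta v w ~H delta v' w'

  data _~T_ : Term → Term → Set where
    ⌊_⌋    : t ~H t' → t ~T t'
    ≈-inst : ∀ {t t' θ θ'} → t ≈ t' → θ ~σ θ' → subT t θ ~T subT t' θ'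

  data _~B_ : List (ℕ × Term) → List (ℕ × Term) → Set where
    []  : [] ~B []
    _∷_ : ∀ {c} → t ~T t' → bs ~B bs' → (c , t) ∷ bs ~B (c , t') ∷ bs'

  data _~S_ : Stack → Stack → Set where
    svar  : ∀ α → svar α ~S svar α
    push  : v ~V v' → π ~S π' → push v π ~S push v' π'
    frame : t ~T t' → π ~S π' → frame t π ~S frame t' π'

  data _~P_ : Proc → Proc → Set where
    _∗_ : t ~T t' → π ~S π' → (t ∗ π) ~P (t' ∗ π')

  record _~σ_ (θ θ' : Subst) : Set where
    inductive
    constructor related
    field
      sv-~ : ∀ n → sv θ n ~V sv θ' n
      ss-~ : ∀ n → ss θ n ~S ss θ' n
      st-~ : ∀ n → st θ n ~T st θ' n
open _~σ_

Lookup-~F : ∀ {l} → fs ~F fs' → Lookup l fs v → Σ[ v' ∈ Val ] Lookup l fs' v' × v ~V v'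
Lookup-~F (d ∷ _)  here          = _ , here , d
Lookup-~F (_ ∷ ds) (there l≢ lk) with Lookup-~F ds lk
... | v' , lk' , d = v' , there l≢ lk' , d

Lookup-~B : ∀ {c} → bs ~B bs' → Lookup c bs t → Σ[ t' ∈ Term ] Lookup c bs' t' × t ~T t'
Lookup-~B (d ∷ _)  here          = _ , here , d
Lookup-~B (_ ∷ ds) (there c≢ lk) with Lookup-~B ds lk
... | t' , lk' , d = t' , there c≢ lk' , d

mutual
  ~V-refl : ∀ v → v ~V v
  ~V-refl (var x)   = var x
  ~V-refl (lam t)   = lam (~T-refl t)
  ~V-refl (con c v) = con c (~V-refl v)
  ~V-refl (rec fs)  = rec (~F-refl fs)

  ~F-refl : ∀ fs → fs ~F fs
  ~F-refl []             = []
  ~F-refl ((l , v) ∷ fs) = ~V-refl v ∷ ~F-refl fs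

  ~T-refl : ∀ t → t ~T t
  ~T-refl (tvar a)    = ⌊ tvar a ⌋
  ~T-refl (val v)     = ⌊ val (~V-refl v) ⌋
  ~T-refl (app t u)   = ⌊ app (~T-refl t) (~T-refl u) ⌋
  ~T-refl (mu t)      = ⌊ mu (~T-refl t) ⌋
  ~T-refl (proc p)    = ⌊ proc (~P-refl p) ⌋
  ~T-refl (proj v l)  = ⌊ proj (~V-refl v) l ⌋
  ~T-refl (case v bs) = ⌊ case (~V-refl v) (~B-refl bs) ⌋
  ~T-refl (delta v w) = ⌊ delta (~V-refl v) (~V-refl w) ⌋

  ~B-refl : ∀ bs → bs ~B bs
  ~B-refl []             = []
  ~B-refl ((c , t) ∷ bs) = ~T-refl t ∷ ~B-refl bs

  ~S-refl : ∀ π → π ~S π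
  ~S-refl (svar α)    = svar α
  ~S-refl (push v π)  = push (~V-refl v) (~S-refl π)
  ~S-refl (frame t π) = frame (~T-refl t) (~S-refl π)

  ~P-refl : ∀ p → p ~P p
  ~P-refl (t ∗ π) = ~T-refl t ∗ ~S-refl π

~σ-refl : ∀ σ → σ ~σ σ
~σ-refl σ = related (~V-refl ∘ sv σ) (~S-refl ∘ ss σ) (~T-refl ∘ st σ)

mutual
  ~V-sym : v ~V v' → v' ~V v
  ~V-sym (var x)   = var x
  ~V-sym (lam d)   = lam (~T-sym d)
  ~V-sym (con c d) = con c (~V-sym d)
  ~V-sym (rec d)   = rec (~F-sym d)

  ~F-sym : fs ~F fs' → fs' ~F fs
  ~F-sym []       = []
  ~F-sym (d ∷ ds) = ~V-sym d ∷ ~F-sym ds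

  ~H-sym : t ~H t' → t' ~H t
  ~H-sym (tvar a)    = tvar a
  ~H-sym (val d)     = val (~V-sym d)
  ~H-sym (app d e)   = app (~T-sym d) (~T-sym e)
  ~H-sym (mu d)      = mu (~T-sym d)
  ~H-sym (proc d)    = proc (~P-sym d)
  ~H-sym (proj d l)  = proj (~V-sym d) l
  ~H-sym (case d e)  = case (~V-sym d) (~B-sym e)
  ~H-sym (delta d e) = delta (~V-sym d) (~V-sym e)

  ~T-sym : t ~T t' → t' ~T t
  ~T-sym ⌊ d ⌋        = ⌊ ~H-sym d ⌋
  ~T-sym (≈-inst {t} {t'} g r) = ≈-inst {t'} {t} (≈-sym {t} {t'} g) (~σ-sym r)

  ~B-sym : bs ~B bs' → bs' ~B bs
  ~B-sym []       = []
  ~B-sym (d ∷ ds) = ~T-sym d ∷ ~B-sym ds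

  ~S-sym : π ~S π' → π' ~S π
  ~S-sym (svar α)    = svar α
  ~S-sym (push d e)  = push (~V-sym d) (~S-sym e)
  ~S-sym (frame d e) = frame (~T-sym d) (~S-sym e)

  ~P-sym : p ~P p' → p' ~P p
  ~P-sym (d ∗ e) = ~T-sym d ∗ ~S-sym e

  ~σ-sym : θ ~σ θ' → θ' ~σ θ
  ~σ-sym (related a b c) = related (λ n → ~V-sym (a n)) (λ n → ~S-sym (b n)) (λ n → ~T-sym (c n))

mutual
  renV-~ : ∀ ρ τ → v ~V v' → renV ρ τ v ~V renV ρ τ v'
  renV-~ ρ τ (var x)   = var (ρ x)
  renV-~ ρ τ (lam d)   = lam (renT-~ (ext ρ) τ d)
  renV-~ ρ τ (con c d) = con c (renV-~ ρ τ d)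
  renV-~ ρ τ (rec d)   = rec (renFs-~ ρ τ d)

  renFs-~ : ∀ ρ τ → fs ~F fs' → renFs ρ τ fs ~F renFs ρ τ fs'
  renFs-~ ρ τ []       = []
  renFs-~ ρ τ (d ∷ ds) = renV-~ ρ τ d ∷ renFs-~ ρ τ ds

  renT-~ : ∀ ρ τ → t ~T t' → renT ρ τ t ~T renT ρ τ t'
  renT-~ ρ τ ⌊ tvar a ⌋    = ⌊ tvar a ⌋
  renT-~ ρ τ ⌊ val d ⌋     = ⌊ val (renV-~ ρ τ d) ⌋
  renT-~ ρ τ ⌊ app d e ⌋   = ⌊ app (renT-~ ρ τ d) (renT-~ ρ τ e) ⌋
  renT-~ ρ τ ⌊ mu d ⌋      = ⌊ mu (renT-~ ρ (ext τ) d) ⌋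
  renT-~ ρ τ ⌊ proc d ⌋    = ⌊ proc (renP-~ ρ τ d) ⌋
  renT-~ ρ τ ⌊ proj d l ⌋  = ⌊ proj (renV-~ ρ τ d) l ⌋
  renT-~ ρ τ ⌊ case d e ⌋  = ⌊ case (renV-~ ρ τ d) (renBs-~ ρ τ e) ⌋
  renT-~ ρ τ ⌊ delta d e ⌋ = ⌊ delta (renV-~ ρ τ d) (renV-~ ρ τ e) ⌋
  renT-~ ρ τ (≈-inst {t} {t'} g r) =
    subst₂ _~T_ (sym (renT-subT ≗ˢ-refl t)) (sym (renT-subT ≗ˢ-refl t')) (≈-inst {t} {t'} g (renσ-~ ρ τ r))

  renBs-~ : ∀ ρ τ → bs ~B bs' → renBs ρ τ bs ~B renBs ρ τ bs'
  renBs-~ ρ τ []       = []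
  renBs-~ ρ τ (d ∷ ds) = renT-~ (ext ρ) τ d ∷ renBs-~ ρ τ ds

  renS-~ : ∀ ρ τ → π ~S π' → renS ρ τ π ~S renS ρ τ π'
  renS-~ ρ τ (svar α)    = svar (τ α)
  renS-~ ρ τ (push d e)  = push (renV-~ ρ τ d) (renS-~ ρ τ e)
  renS-~ ρ τ (frame d e) = frame (renT-~ ρ τ d) (renS-~ ρ τ e)

  renP-~ : ∀ ρ τ → p ~P p' → renP ρ τ p ~P renP ρ τ p'
  renP-~ ρ τ (d ∗ e) = renT-~ ρ τ d ∗ renS-~ ρ τ e

  renσ-~ : ∀ ρ τ → θ ~σ θ' → renameSubst ρ τ θ ~σ renameSubst ρ τ θ'
  renσ-~ ρ τ (related a b c) = related (λ n → renV-~ ρ τ (a n)) (λ n → renS-~ ρ τ (b n)) (λ n → renT-~ ρ τ (c n))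

liftλ-~ : θ ~σ θ' → liftλ θ ~σ liftλ θ'
liftλ-~ (related a b c) = related (λ { zero → var zero ; (suc n) → renV-~ suc id (a n) })
                                  (λ n → renS-~ suc id (b n)) (λ n → renT-~ suc id (c n))

liftμ-~ : θ ~σ θ' → liftμ θ ~σ liftμ θ'
liftμ-~ (related a b c) = related (λ n → renV-~ id suc (a n))
                                  (λ { zero → svar zero ; (suc n) → renS-~ id suc (b n) })
                                  (λ n → renT-~ id suc (c n))

mutual
  subV-~ : v ~V v' → σ ~σ σ' → subV v σ ~V subV v' σ'
  subV-~ (var x)   r = sv-~ r x
  subV-~ (lam d)   r = lam (subT-~ d (liftλ-~ r))
  subV-~ (con c d) r = con c (subV-~ d r)
  subV-~ (rec d)   r = rec (subFs-~ d r)

  subFs-~ : fs ~F fs' → σ ~σ σ' → subFs fs σ ~F subFs fs' σ'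
  subFs-~ []       r = []
  subFs-~ (d ∷ ds) r = subV-~ d r ∷ subFs-~ ds r

  subT-~ : t ~T t' → σ ~σ σ' → subT t σ ~T subT t' σ'
  subT-~ ⌊ tvar a ⌋    r = st-~ r a
  subT-~ ⌊ val d ⌋     r = ⌊ val (subV-~ d r) ⌋
  subT-~ ⌊ app d e ⌋   r = ⌊ app (subT-~ d r) (subT-~ e r) ⌋
  subT-~ ⌊ mu d ⌋      r = ⌊ mu (subT-~ d (liftμ-~ r)) ⌋
  subT-~ ⌊ proc d ⌋    r = ⌊ proc (subP-~ d r) ⌋
  subT-~ ⌊ proj d l ⌋  r = ⌊ proj (subV-~ d r) l ⌋
  subT-~ ⌊ case d e ⌋  r = ⌊ case (subV-~ d r) (subBs-~ e r) ⌋
  subT-~ ⌊ delta d e ⌋ r = ⌊ delta (subV-~ d r) (subV-~ e r) ⌋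
  subT-~ (≈-inst {t} {t'} g r₀) r =
    subst₂ _~T_ (sym (subT-subT ≗ˢ-refl t)) (sym (subT-subT ≗ˢ-refl t')) (≈-inst {t} {t'} g (⨾-~ r₀ r))

  subBs-~ : bs ~B bs' → σ ~σ σ' → subBs bs σ ~B subBs bs' σ'
  subBs-~ []       r = []
  subBs-~ (d ∷ ds) r = subT-~ d (liftλ-~ r) ∷ subBs-~ ds r

  subS-~ : π ~S π' → σ ~σ σ' → subS π σ ~S subS π' σ'
  subS-~ (svar α)    r = ss-~ r α
  subS-~ (push d e)  r = push (subV-~ d r) (subS-~ e r)
  subS-~ (frame d e) r = frame (subT-~ d r) (subS-~ e r)

  subP-~ : p ~P p' → σ ~σ σ' → subP p σ ~P subP p' σ'
  subP-~ (d ∗ e) r = subT-~ d r ∗ subS-~ e r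

  ⨾-~ : θ ~σ θ' → σ ~σ σ' → θ ⨾ σ ~σ θ' ⨾ σ'
  ⨾-~ (related a b c) r = related (λ n → subV-~ (a n) r) (λ n → subS-~ (b n) r) (λ n → subT-~ (c n) r)

x≔-~ : t ~T t' → v ~V v' → t [x≔ v ] ~T t' [x≔ v' ]
x≔-~ d dv = subT-~ d (related (λ { zero → dv ; (suc n) → var n }) svar (λ a → ⌊ tvar a ⌋))

α≔-~ : t ~T t' → π ~S π' → t [α≔ π ] ~T t' [α≔ π' ]
α≔-~ d dπ = subT-~ d (related var (λ { zero → dπ ; (suc n) → svar n }) (λ a → ⌊ tvar a ⌋))

≈⇒~T : t ≈ t' → t ~T t'
≈⇒~T {t} {t'} g = subst₂ _~T_ (subT-id ≗ˢ-refl t) (subT-id ≗ˢ-refl t') (≈-inst {t} {t'} g (~σ-refl idˢ))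

data Head (θ θ' : Subst) : Term → Set where
  tvar  : ∀ b → Head θ θ' (tvar b)
  other : subT t θ ~H subT t θ' → Head θ θ' t

head : ∀ t → θ ~σ θ' → Head θ θ' t
head (tvar b)    r = tvar b
head (val v)     r = other (val (subV-~ (~V-refl v) r))
head (app t u)   r = other (app (subT-~ (~T-refl t) r) (subT-~ (~T-refl u) r))
head (mu t)      r = other (mu (subT-~ (~T-refl t) (liftμ-~ r)))
head (proc p)    r = other (proc (subP-~ (~P-refl p) r))
head (proj v l)  r = other (proj (subV-~ (~V-refl v) r) l)
head (case v bs) r = other (case (subV-~ (~V-refl v) r) (subBs-~ (~B-refl bs) r))
head (delta v w) r = other (delta (subV-~ (~V-refl v) r) (subV-~ (~V-refl w) r))

module Simulation
  (j : ℕ) (E : ∀ k → k < j → Term → Term → Set)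
  (E-resp : ∀ {k} (k<j : k < j) {v v' w w'} → v ~V v' → w ~V w' →
            E k k<j (val v') (val w') → E k k<j (val v) (val w))
  (≈-halts : ∀ {t t'} → t ≈ t' → ∀ σ π →
             Halts (StepWith j E) (subT t σ ∗ π) → Halts (StepWith j E) (subT t' σ ∗ π))
  where

  mutual
    halts-~T : ∀ {q} → Star (StepWith j E) (t ∗ π) q → Final q → t ~T t' → π ~S π' →
               Halts (StepWith j E) (t' ∗ π')
    halts-~T s f ⌊ d ⌋ dπ = halts-~H s f d dπ
    halts-~T s f (≈-inst {t} {t'} {θ} {θ'} g r) dπ with head t r
    ... | tvar b  = ≈-halts {t} {t'} g θ' _ (halts-~T s f (st-~ r b) dπ)
    ... | other d = ≈-halts {t} {t'} g θ' _ (halts-~H s f d dπ)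

    halts-~H : ∀ {q} → Star (StepWith j E) (t ∗ π) q → Final q → t ~H t' → π ~S π' →
               Halts (StepWith j E) (t' ∗ π')
    halts-~H ε final (val d) (svar α) = _ , ε , final
    halts-~H (inj₁ ≻-app ◅ s) f (app dt du) dπ =
      inj₁ ≻-app ◅ₕ halts-~T s f du (frame dt dπ)
    halts-~H (inj₁ ≻-frame ◅ s) f (val dv) (frame dt dπ) =
      inj₁ ≻-frame ◅ₕ halts-~T s f dt (push dv dπ)
    halts-~H (inj₁ ≻-lam ◅ s) f (val (lam dt)) (push dv dπ) =
      inj₁ ≻-lam ◅ₕ halts-~T s f (x≔-~ dt dv) dπ
    halts-~H (inj₁ ≻-mu ◅ s) f (mu dt) dπ =
      inj₁ ≻-mu ◅ₕ halts-~T s f (α≔-~ dt dπ) dπ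
    halts-~H (inj₁ ≻-proc ◅ s) f (proc (dt ∗ dπ)) _ =
      inj₁ ≻-proc ◅ₕ halts-~T s f dt dπ
    halts-~H (inj₁ (≻-proj lk) ◅ s) f (proj (rec dfs) l) dπ with Lookup-~F dfs lk
    ... | _ , lk' , dv = inj₁ (≻-proj lk') ◅ₕ halts-~T s f ⌊ val dv ⌋ dπ
    halts-~H (inj₁ (≻-case lk) ◅ s) f (case (con c dv) dbs) dπ with Lookup-~B dbs lk
    ... | _ , lk' , dt = inj₁ (≻-case lk') ◅ₕ halts-~T s f (x≔-~ dt dv) dπ
    halts-~H (inj₂ (_ , _ , _ , refl , refl , k , k<j , v≢w) ◅ s) f (delta dv dw) dπ =
      inj₂ (_ , _ , _ , refl , refl , k , k<j , v≢w ∘ E-resp k<j dv dw) ◅ₕ halts-~T s f ⌊ val dv ⌋ dπ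

~T⇒EquivAcc : ∀ {i} (a : Acc _<_ i) → t ~T t' → EquivAcc i a t t'
~T⇒EquivAcc {i = i} (acc rs) d j j≤i π σ = transfer d , transfer (~T-sym d)
  where
  E : ∀ k → k < j → Term → Term → Set
  E k k<j = EquivAcc k (rs (<-≤-trans k<j j≤i))

  E-resp : ∀ {k} (k<j : k < j) {v v' w w'} → v ~V v' → w ~V w' →
           E k k<j (val v') (val w') → E k k<j (val v) (val w)
  E-resp k<j {v} {v'} {w} dv dw e =
    EquivAcc-trans (rs k<i) {val v} (~T⇒EquivAcc (rs k<i) ⌊ val dv ⌋)
      (EquivAcc-trans (rs k<i) {val v'} e (EquivAcc-sym (rs k<i) {val w} (~T⇒EquivAcc (rs k<i) ⌊ val dw ⌋)))
    where k<i = <-≤-trans k<j j≤i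

  open Simulation j E E-resp
    (λ {t} {t'} g σ π → proj₁ (EquivAcc-irrelevant (<-wellFounded i) (acc rs) {t} {t'} (g i) j j≤i π σ))

  transfer : ∀ {t t'} → t ~T t' → Halts (StepWith j E) (subT t σ ∗ π) → Halts (StepWith j E) (subT t' σ ∗ π)
  transfer d (_ , s , f) = halts-~T s f (subT-~ d (~σ-refl σ)) (~S-refl π)

≔-~σ : ∀ a → t ~T t' →
       ⟨ var , svar , (λ b → if a ≡ᵇ b then t else tvar b) ⟩ ~σ ⟨ var , svar , (λ b → if a ≡ᵇ b then t' else tvar b) ⟩
≔-~σ a d = related var svar pick
  where
  pick : ∀ b → (if a ≡ᵇ b then _ else tvar b) ~T (if a ≡ᵇ b then _ else tvar b)
  pick b with a ≡ᵇ b
  ... | true  = d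
  ... | false = ⌊ tvar b ⌋

theorem3 : (t₁ t₂ E : Term) (a : ℕ) → t₁ ≈ t₂ → (E [ a ≔ t₁ ]) ≈ (E [ a ≔ t₂ ])
theorem3 t₁ t₂ E a t₁≈t₂ i = ~T⇒EquivAcc (<-wellFounded i) (subT-~ (~T-refl E) (≔-~σ a (≈⇒~T t₁≈t₂)))
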